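{- Let $G$ be any graph. Then $\gamma_R(\mu(G))=\gamma_R(G)+1$ if and only if $G$ is a special Roman graph.
   Context: All graphs are finite and simple. A Roman dominating function (RDF) of $G=(V,E)$ is a function $f:V\to\{0,1,2\}$ such that every vertex $v$ with $f(v)=0$ has a neighbor $w$ with $f(w)=2$; its weight is $\sum_v f(v)$, $\gamma_R(G)$ is the minimum weight of an RDF, and a $\gamma_R$-function is an RDF of weight $\gamma_R(G)$. Write $f=(V_0,V_1,V_2)$ with $V_i=\{v:f(v)=i\}$. $G$ is a special Roman graph if it has a $\gamma_R$-function $f=(V_0,V_1,V_2)$ with $V_1=\emptyset$ such that $G[V_2]$ has no isolated vertex. The Mycielskian $\mu(G)$ of $G$ with $V(G)=\{v_1^0,\ldots,v_n^0\}$ has vertex set $\{v_j^0\}\cup\{v_j^1\}\cup\{u\}$ and edge set $E(G)\cup\{v_j^0v_{j'}^1 : v_j^0v_{j'}^0\in E(G)\}\cup\{v_j^1u: 1\leq j\leq n\}$. -}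

module Defs where

open import Data.Nat using (ℕ; zero; suc; _+_; _≤_)
open import Data.Fin using (Fin; zero; suc; splitAt)
open import Data.Bool using (Bool; true; false; _∧_)
open import Data.Sum using (_⊎_; inj₁; inj₂)
open import Data.Product using (Σ; ∃; _×_; _,_)
open import Data.Empty using (⊥)
open import Relation.Binary.PropositionalEquality using (_≡_)
open import Relation.Nullary using (¬_)

record Graph (n : ℕ) : Set where
  field
    adj     : Fin n → Fin n → Bool
    sym     : ∀ x y → adj x y ≡ adj y x
    irrefl  : ∀ x → adj x x ≡ false
open Graph public

Adj : ∀ {n} → Graph n → Fin n → Fin n → Set
Adj G x y = adj G x y ≡ true

val : Fin 3 → ℕ
val zero = 0
val (suc zero) = 1
val (suc (suc zero)) = 2

sumFin : ∀ n → (Fin n → ℕ) → ℕ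
sumFin zero f = 0
sumFin (suc n) f = f zero + sumFin n (λ i → f (suc i))

weight : ∀ {n} → (Fin n → Fin 3) → ℕ
weight {n} f = sumFin n (λ v → val (f v))

IsRDF : ∀ {n} → Graph n → (Fin n → Fin 3) → Set
IsRDF {n} G f = ∀ v → f v ≡ zero → Σ (Fin n) λ w → Adj G v w × f w ≡ suc (suc zero)

IsRomanDomNumber : ∀ {n} → Graph n → ℕ → Set
IsRomanDomNumber {n} G k =
  (Σ (Fin n → Fin 3) λ f → IsRDF G f × weight f ≡ k)
  × (∀ (f : Fin n → Fin 3) → IsRDF G f → k ≤ weight f)

IsGammaRFunction : ∀ {n} → Graph n → (Fin n → Fin 3) → Set
IsGammaRFunction G f = IsRDF G f × (∀ g → IsRDF G g → weight f ≤ weight g)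

-- special Roman graph: some γ_R-function with V₁ = ∅ and G[V₂] without
-- isolated vertices
IsSpecialRoman : ∀ {n} → Graph n → Set
IsSpecialRoman {n} G = Σ (Fin n → Fin 3) λ f →
  IsGammaRFunction G f
  × (∀ v → ¬ (f v ≡ suc zero))
  × (∀ v → f v ≡ suc (suc zero) →
       Σ (Fin n) λ w → Adj G v w × f w ≡ suc (suc zero))

-- Mycielskian. Vertices of μ(G): Fin (suc (n + n)); zero is u,
-- suc i with splitAt n i = inj₁ j is v_j^0, inj₂ j is v_j^1.
data MyVert (n : ℕ) : Set where
  u  : MyVert n
  v0 : Fin n → MyVert n
  v1 : Fin n → MyVert n

classify : ∀ {n} → Fin (suc (n + n)) → MyVert n
classify zero = u
classify {n} (suc i) with splitAt n i
... | inj₁ j = v0 j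
... | inj₂ j = v1 j

myAdj : ∀ {n} → Graph n → MyVert n → MyVert n → Bool
myAdj G u u = false
myAdj G u (v0 _) = false
myAdj G u (v1 _) = true
myAdj G (v0 _) u = false
myAdj G (v0 a) (v0 b) = adj G a b
myAdj G (v0 a) (v1 b) = adj G a b
myAdj G (v1 _) u = true
myAdj G (v1 a) (v0 b) = adj G a b
myAdj G (v1 _) (v1 _) = false

myAdj-sym : ∀ {n} (G : Graph n) x y → myAdj G x y ≡ myAdj G y x
myAdj-sym G u u = Relation.Binary.PropositionalEquality.refl
myAdj-sym G u (v0 _) = Relation.Binary.PropositionalEquality.refl
myAdj-sym G u (v1 _) = Relation.Binary.PropositionalEquality.refl
myAdj-sym G (v0 _) u = Relation.Binary.PropositionalEquality.refl
myAdj-sym G (v0 a) (v0 b) = sym G a b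
myAdj-sym G (v0 a) (v1 b) = sym G a b
myAdj-sym G (v1 _) u = Relation.Binary.PropositionalEquality.refl
myAdj-sym G (v1 a) (v0 b) = sym G a b
myAdj-sym G (v1 _) (v1 _) = Relation.Binary.PropositionalEquality.refl

myAdj-irrefl : ∀ {n} (G : Graph n) x → myAdj G x x ≡ false
myAdj-irrefl G u = Relation.Binary.PropositionalEquality.refl
myAdj-irrefl G (v0 a) = irrefl G a
myAdj-irrefl G (v1 _) = Relation.Binary.PropositionalEquality.refl

mycielskian : ∀ {n} → Graph n → Graph (suc (n + n))
mycielskian G = record
  { adj = λ x y → myAdj G (classify x) (classify y)
  ; sym = λ x y → myAdj-sym G (classify x) (classify y)
  ; irrefl = λ x → myAdj-irrefl G (classify x)
  }

-- Write g₀, g₁ for the restrictions of an RDF g of μ(G) to the two copies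
-- of V(G), so that weight g = g(u) + Σⱼ (g₀ j + g₁ j).  Each RDF of μ(G)
-- projects to an RDF of G of weight at most Σⱼ (g₀ j + g₁ j): take
-- max(g₀, g₁) when g(u) = 2, and otherwise merge the two labels, keeping a 2
-- from either copy and the minimum of two labels below 2.  When g(u) = 0 some
-- v¹ₐ carries a 2, and a finer projection of g₀ saves 2 more.  Hence
-- γ_R(μ(G)) ≥ γ_R(G) + 1, with equality only if g(u) = 1 and the merge is
-- exact at every vertex, which forces it to be a special Roman function.
-- Conversely a special Roman function f extends to μ(G) by 1 on u and 0 on
-- the second copy: each v¹ⱼ sees the 2-labelled neighbour of v⁰ⱼ.
module Submission where

open import Defs hiding (sym)
open import Data.Nat using (ℕ; zero; suc; _+_; _∸_; _≤_; z≤n; s≤s)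
open import Data.Nat.Properties
  using ( +-comm; +-identityʳ; +-assoc; +-monoʳ-≤; +-mono-≤; +-commutativeSemigroup
        ; ≤-refl; ≤-trans; ≤-antisym; _≤?_; ≰⇒>; <⇒≱; m≤m+n; m≤n+m
        ; m+[n∸m]≡n; m+n≤o⇒m≤o∸n; +-suc; +-monoˡ-≤; m+1+n≰m; suc-injective; module ≤-Reasoning )
open import Algebra.Properties.CommutativeSemigroup +-commutativeSemigroup
  using (interchange)
open import Data.Fin using (Fin; zero; suc; _↑ˡ_; _↑ʳ_; splitAt)
open import Data.Fin.Properties
  using (splitAt-↑ˡ; splitAt-↑ʳ; splitAt⁻¹-↑ˡ; splitAt⁻¹-↑ʳ; any?)
  renaming (_≟_ to _≟ᶠ_)
open import Data.Bool using (true)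
open import Data.Bool.Properties using () renaming (_≟_ to _≟ᵇ_)
open import Data.Sum using (_⊎_; inj₁; inj₂)
open import Data.Product using (Σ; _×_; _,_; proj₁; proj₂)
open import Function using (_∘_)
open import Function.Bundles using (_⇔_; mk⇔)
open import Relation.Binary.PropositionalEquality
  using (_≡_; _≢_; refl; sym; trans; cong; cong₂; subst)
open import Relation.Nullary using (¬_; Dec; yes; no; contradiction)
open import Relation.Nullary.Decidable using (_×-dec_)

pattern 𝟙 = suc zero
pattern 𝟚 = suc (suc zero)

sumFin-cong : ∀ {n} {f g : Fin n → ℕ} → (∀ i → f i ≡ g i) → sumFin n f ≡ sumFin n g
sumFin-cong {n = zero}  eq = refl
sumFin-cong {n = suc n} eq = cong₂ _+_ (eq zero) (sumFin-cong (eq ∘ suc))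

sumFin-+ : ∀ {n} (f g : Fin n → ℕ) → sumFin n (λ i → f i + g i) ≡ sumFin n f + sumFin n g
sumFin-+ {n = zero}  f g = refl
sumFin-+ {n = suc n} f g =
  trans (cong (f zero + g zero +_) (sumFin-+ (f ∘ suc) (g ∘ suc)))
        (interchange (f zero) (g zero) _ _)

≤-sumFin : ∀ {n} (f : Fin n → ℕ) (a : Fin n) → f a ≤ sumFin n f
≤-sumFin {n = suc n} f zero    = m≤m+n _ _
≤-sumFin {n = suc n} f (suc a) = ≤-trans (≤-sumFin (f ∘ suc) a) (m≤n+m _ _)

+-≤-sumFin : ∀ {n} (f : Fin n → ℕ) {a b : Fin n} → a ≢ b → f a + f b ≤ sumFin n f
+-≤-sumFin {n = suc n} f {zero}  {zero}  a≢b = contradiction refl a≢b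
+-≤-sumFin {n = suc n} f {zero}  {suc b} a≢b = +-monoʳ-≤ (f zero) (≤-sumFin (f ∘ suc) b)
+-≤-sumFin {n = suc n} f {suc a} {zero}  a≢b =
  subst (_≤ sumFin (suc n) f) (+-comm (f zero) (f (suc a)))
        (+-monoʳ-≤ (f zero) (≤-sumFin (f ∘ suc) a))
+-≤-sumFin {n = suc n} f {suc a} {suc b} a≢b =
  ≤-trans (+-≤-sumFin (f ∘ suc) (a≢b ∘ cong suc)) (m≤n+m _ _)

sumFin-mono-+ : ∀ {n} (f g : Fin n → ℕ) → (∀ i → f i ≤ g i) → {c : ℕ} →
  c ≤ sumFin n (λ i → g i ∸ f i) → sumFin n f + c ≤ sumFin n g
sumFin-mono-+ {n} f g f≤g c≤ =
  subst (sumFin n f + _ ≤_) sum-excess (+-monoʳ-≤ (sumFin n f) c≤)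
  where
  sum-excess : sumFin n f + sumFin n (λ i → g i ∸ f i) ≡ sumFin n g
  sum-excess = trans (sym (sumFin-+ f _)) (sumFin-cong (λ i → m+[n∸m]≡n (f≤g i)))

m+n≤o⇒n≤o∸m : ∀ {m o} n → m + n ≤ o → n ≤ o ∸ m
m+n≤o⇒n≤o∸m {m} {o} n le = m+n≤o⇒m≤o∸n n (subst (_≤ o) (+-comm m n) le)

sumFin-mono : ∀ {n} (f g : Fin n → ℕ) → (∀ i → f i ≤ g i) → sumFin n f ≤ sumFin n g
sumFin-mono f g f≤g = ≤-trans (m≤m+n _ 0) (sumFin-mono-+ f g f≤g z≤n)

sumFin-mono-+-at : ∀ {n} (f g : Fin n → ℕ) → (∀ i → f i ≤ g i) → {c : ℕ} (a : Fin n) →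
  f a + c ≤ g a → sumFin n f + c ≤ sumFin n g
sumFin-mono-+-at f g f≤g {c} a le =
  sumFin-mono-+ f g f≤g (≤-trans (m+n≤o⇒n≤o∸m c le) (≤-sumFin (λ i → g i ∸ f i) a))

sumFin-mono-+-at₂ : ∀ {n} (f g : Fin n → ℕ) → (∀ i → f i ≤ g i) → {a b : Fin n} → a ≢ b →
  f a + 1 ≤ g a → f b + 1 ≤ g b → sumFin n f + 2 ≤ sumFin n g
sumFin-mono-+-at₂ f g f≤g a≢b lea leb =
  sumFin-mono-+ f g f≤g
    (≤-trans (+-mono-≤ (m+n≤o⇒n≤o∸m 1 lea) (m+n≤o⇒n≤o∸m 1 leb)) (+-≤-sumFin (λ i → g i ∸ f i) a≢b))

sumFin-mono-exact : ∀ {n} (f g : Fin n → ℕ) → (∀ i → f i ≤ g i) →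
  sumFin n g ≤ sumFin n f → ∀ i → g i ≤ f i
sumFin-mono-exact {n} f g f≤g Σg≤Σf i with g i ≤? f i
... | yes gi≤fi = gi≤fi
... | no gi≰fi =
  contradiction Σg≤Σf
    (<⇒≱ (subst (_≤ sumFin n g) (+-comm (sumFin n f) 1)
           (sumFin-mono-+-at f g f≤g i
             (subst (_≤ g i) (+-comm 1 (f i)) (≰⇒> gi≰fi)))))

sumFin-↑ : ∀ {n} m (f : Fin (m + n) → ℕ) →
  sumFin (m + n) f ≡ sumFin m (λ i → f (i ↑ˡ n)) + sumFin n (λ j → f (m ↑ʳ j))
sumFin-↑ {n} zero    f = refl
sumFin-↑ {n} (suc m) f = trans (cong (f zero +_) (sumFin-↑ m (f ∘ suc))) (sym (+-assoc (f zero) _ _))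

adj⇒≢ : ∀ {n} (G : Graph n) {a b : Fin n} → Adj G a b → a ≢ b
adj⇒≢ G {a} a~a refl with trans (sym a~a) (irrefl G a)
... | ()

_⊔_ : Fin 3 → Fin 3 → Fin 3
zero ⊔ b    = b
𝟙    ⊔ zero = 𝟙
𝟙    ⊔ b    = b
𝟚    ⊔ _    = 𝟚

⊔-≡0 : ∀ a b → a ⊔ b ≡ zero → a ≡ zero
⊔-≡0 zero b       _ = refl
⊔-≡0 𝟙    zero    ()
⊔-≡0 𝟙    (suc _) ()
⊔-≡0 𝟚    _       ()

⊔-𝟚 : ∀ a b → a ≡ 𝟚 ⊎ b ≡ 𝟚 → a ⊔ b ≡ 𝟚
⊔-𝟚 .𝟚   b    (inj₁ refl) = refl
⊔-𝟚 zero .𝟚   (inj₂ refl) = refl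
⊔-𝟚 𝟙    .𝟚   (inj₂ refl) = refl
⊔-𝟚 𝟚    .𝟚   (inj₂ refl) = refl

val-⊔ : ∀ a b → val (a ⊔ b) ≤ val a + val b
val-⊔ zero b    = ≤-refl
val-⊔ 𝟙    zero = ≤-refl
val-⊔ 𝟙    𝟙    = s≤s z≤n
val-⊔ 𝟙    𝟚    = s≤s (s≤s z≤n)
val-⊔ 𝟚    b    = m≤m+n 2 (val b)

≡𝟙⇒≢𝟚 : {c : Fin 3} → c ≡ 𝟙 → c ≢ 𝟚
≡𝟙⇒≢𝟚 refl ()

merge : Fin 3 → Fin 3 → Fin 3
merge 𝟚    _    = 𝟚
merge zero 𝟚    = 𝟚
merge 𝟙    𝟚    = 𝟚
merge 𝟙    𝟙    = 𝟙
merge _    _    = zero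

merge-≡0 : ∀ a b → merge a b ≡ zero → a ≡ zero ⊎ b ≡ zero
merge-≡0 zero b    _ = inj₁ refl
merge-≡0 𝟙    zero _ = inj₂ refl
merge-≡0 𝟙    𝟙    ()
merge-≡0 𝟙    𝟚    ()
merge-≡0 𝟚    _    ()

merge-𝟚 : ∀ a b → a ≡ 𝟚 ⊎ b ≡ 𝟚 → merge a b ≡ 𝟚
merge-𝟚 .𝟚   b    (inj₁ refl) = refl
merge-𝟚 zero .𝟚   (inj₂ refl) = refl
merge-𝟚 𝟙    .𝟚   (inj₂ refl) = refl
merge-𝟚 𝟚    .𝟚   (inj₂ refl) = refl

val-merge : ∀ a b → val (merge a b) ≤ val a + val b
val-merge zero zero = z≤n
val-merge zero 𝟙    = z≤n
val-merge zero 𝟚    = ≤-refl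
val-merge 𝟙    zero = z≤n
val-merge 𝟙    𝟙    = s≤s z≤n
val-merge 𝟙    𝟚    = s≤s (s≤s z≤n)
val-merge 𝟚    b    = m≤m+n 2 (val b)

merge-exact : ∀ a b → val a + val b ≤ val (merge a b) → (a ≡ zero ⊎ b ≡ zero) × merge a b ≢ 𝟙
merge-exact zero zero _ = inj₁ refl , λ ()
merge-exact zero 𝟚    _ = inj₁ refl , λ ()
merge-exact 𝟚    zero _ = inj₂ refl , λ ()
merge-exact zero 𝟙    ()
merge-exact 𝟙    zero ()
merge-exact 𝟙    𝟙    (s≤s ())
merge-exact 𝟙    𝟚    (s≤s (s≤s ()))
merge-exact 𝟚    𝟙    (s≤s (s≤s ()))
merge-exact 𝟚    𝟚    (s≤s (s≤s ()))

raise : {X : Set} → Fin 3 → Dec X → Fin 3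
raise zero (yes _) = zero
raise zero (no _)  = 𝟙
raise a    _       = a

raise-≡0 : {X : Set} (a : Fin 3) (d : Dec X) → raise a d ≡ zero → X
raise-≡0 zero (yes x) _ = x

raise-𝟚 : {X : Set} {a : Fin 3} (d : Dec X) → a ≡ 𝟚 → raise a d ≡ 𝟚
raise-𝟚 d refl = refl

val-raise : {X : Set} (a b : Fin 3) (d : Dec X) → (¬ X → b ≢ zero) → val (raise a d) ≤ val a + val b
val-raise zero zero (no ¬x) b≢0 = contradiction refl (b≢0 ¬x)
val-raise zero 𝟙    (no ¬x) _   = ≤-refl
val-raise zero 𝟚    (no ¬x) _   = s≤s z≤n
val-raise zero b    (yes _) _   = z≤n
val-raise (suc a) b d       _   = m≤m+n _ _

raise-+1 : {X : Set} (a : Fin 3) {b : Fin 3} (d : Dec X) → b ≡ 𝟚 → val (raise a d) + 1 ≤ val a + val b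
raise-+1 zero    (yes _) refl = s≤s z≤n
raise-+1 zero    (no _)  refl = ≤-refl
raise-+1 (suc a) d       refl = +-monoʳ-≤ (val (suc a)) (s≤s z≤n)

raise-+2 : {X : Set} (a : Fin 3) {b : Fin 3} (d : Dec X) → b ≡ 𝟚 → a ≢ zero ⊎ X →
  val (raise a d) + 2 ≤ val a + val b
raise-+2 zero    (yes _) refl _          = ≤-refl
raise-+2 zero    (no _)  refl (inj₁ a≢0) = contradiction refl a≢0
raise-+2 zero    (no ¬x) refl (inj₂ x)   = contradiction x ¬x
raise-+2 (suc a) d       refl _          = ≤-refl

module _ {n : ℕ} where

  embed : MyVert n → Fin (suc (n + n))
  embed u      = zero
  embed (v0 j) = suc (j ↑ˡ n)
  embed (v1 j) = suc (n ↑ʳ j)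

  classify-embed : (m : MyVert n) → classify (embed m) ≡ m
  classify-embed u      = refl
  classify-embed (v0 j) rewrite splitAt-↑ˡ n j n = refl
  classify-embed (v1 j) rewrite splitAt-↑ʳ n n j = refl

  embed-classify : (x : Fin (suc (n + n))) → embed (classify x) ≡ x
  embed-classify zero = refl
  embed-classify (suc i) with splitAt n {n} i in eq
  ... | inj₁ j = cong suc (splitAt⁻¹-↑ˡ eq)
  ... | inj₂ j = cong suc (splitAt⁻¹-↑ʳ eq)

  MyDominated : Graph n → (MyVert n → Fin 3) → MyVert n → Set
  MyDominated G F m = Σ (MyVert n) λ m' → myAdj G m m' ≡ true × F m' ≡ 𝟚

  rdf-mycielskian⇒ : (G : Graph n) {g : Fin (suc (n + n)) → Fin 3} → IsRDF (mycielskian G) g →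
    ∀ m → g (embed m) ≡ zero → MyDominated G (g ∘ embed) m
  rdf-mycielskian⇒ G {g} rdf m gm≡0 with rdf (embed m) gm≡0
  ... | y , m~y , gy≡𝟚 =
    classify y ,
    subst (λ z → myAdj G z (classify y) ≡ true) (classify-embed m) m~y ,
    subst (λ z → g z ≡ 𝟚) (sym (embed-classify y)) gy≡𝟚

  rdf-mycielskian⇐ : (G : Graph n) (F : MyVert n → Fin 3) →
    (∀ m → F m ≡ zero → MyDominated G F m) → IsRDF (mycielskian G) (F ∘ classify)
  rdf-mycielskian⇐ G F dom x Fx≡0 with dom (classify x) Fx≡0
  ... | m' , x~m' , Fm'≡𝟚 =
    embed m' ,
    subst (λ z → myAdj G (classify x) z ≡ true) (sym (classify-embed m')) x~m' ,
    subst (λ z → F z ≡ 𝟚) (sym (classify-embed m')) Fm'≡𝟚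

  weight-mycielskian : (g : Fin (suc (n + n)) → Fin 3) →
    weight g ≡ val (g (embed u)) + sumFin n (λ j → val (g (embed (v0 j))) + val (g (embed (v1 j))))
  weight-mycielskian g =
    cong (val (g zero) +_)
      (trans (sumFin-↑ n (λ i → val (g (suc i))))
             (sym (sumFin-+ (λ j → val (g (embed (v0 j)))) (λ j → val (g (embed (v1 j)))))))

module Projection {n} (G : Graph n) (g : Fin (suc (n + n)) → Fin 3)
                  (rdf : IsRDF (mycielskian G) g) where

  gᵤ : Fin 3
  gᵤ = g zero

  g₀ g₁ : Fin n → Fin 3
  g₀ j = g (embed (v0 j))
  g₁ j = g (embed (v1 j))

  layer : Fin n → ℕ
  layer j = val (g₀ j) + val (g₁ j)

  weight-layers : weight g ≡ val gᵤ + sumFin n layer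
  weight-layers = weight-mycielskian {n} g

  V0Dominated : Fin n → Set
  V0Dominated j = Σ (Fin n) λ j' → Adj G j j' × g₀ j' ≡ 𝟚

  v0-dominated : ∀ j → g₀ j ≡ zero → Σ (Fin n) λ j' → Adj G j j' × (g₀ j' ≡ 𝟚 ⊎ g₁ j' ≡ 𝟚)
  v0-dominated j g₀j≡0 with rdf-mycielskian⇒ G rdf (v0 j) g₀j≡0
  ... | v0 j' , j~j' , e = j' , j~j' , inj₁ e
  ... | v1 j' , j~j' , e = j' , j~j' , inj₂ e

  v1-dominated : ∀ j → g₁ j ≡ zero → gᵤ ≡ 𝟚 ⊎ V0Dominated j
  v1-dominated j g₁j≡0 with rdf-mycielskian⇒ G rdf (v1 j) g₁j≡0
  ... | u     , _    , e = inj₁ e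
  ... | v0 j' , j~j' , e = inj₂ (j' , j~j' , e)

  u-dominated : gᵤ ≡ zero → Σ (Fin n) λ a → g₁ a ≡ 𝟚
  u-dominated gᵤ≡0 with rdf-mycielskian⇒ G rdf u gᵤ≡0
  ... | v1 a , _ , e = a , e

  maxProj : Fin n → Fin 3
  maxProj j = g₀ j ⊔ g₁ j

  maxProj-rdf : IsRDF G maxProj
  maxProj-rdf j eq with v0-dominated j (⊔-≡0 (g₀ j) (g₁ j) eq)
  ... | j' , j~j' , e = j' , j~j' , ⊔-𝟚 (g₀ j') (g₁ j') e

  maxProj-weight : weight maxProj ≤ sumFin n layer
  maxProj-weight = sumFin-mono _ layer (λ j → val-⊔ (g₀ j) (g₁ j))

  module Merge (gᵤ≢𝟚 : gᵤ ≢ 𝟚) where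

    mergeProj : Fin n → Fin 3
    mergeProj j = merge (g₀ j) (g₁ j)

    mergeProj-dominated : ∀ j → g₀ j ≡ zero ⊎ g₁ j ≡ zero →
      Σ (Fin n) λ j' → Adj G j j' × mergeProj j' ≡ 𝟚
    mergeProj-dominated j (inj₁ g₀j≡0) with v0-dominated j g₀j≡0
    ... | j' , j~j' , e = j' , j~j' , merge-𝟚 (g₀ j') (g₁ j') e
    mergeProj-dominated j (inj₂ g₁j≡0) with v1-dominated j g₁j≡0
    ... | inj₁ gᵤ≡𝟚              = contradiction gᵤ≡𝟚 gᵤ≢𝟚
    ... | inj₂ (j' , j~j' , e) = j' , j~j' , merge-𝟚 (g₀ j') (g₁ j') (inj₁ e)

    mergeProj-rdf : IsRDF G mergeProj
    mergeProj-rdf j eq = mergeProj-dominated j (merge-≡0 (g₀ j) (g₁ j) eq)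

    val-mergeProj : ∀ j → val (mergeProj j) ≤ layer j
    val-mergeProj j = val-merge (g₀ j) (g₁ j)

    mergeProj-weight : weight mergeProj ≤ sumFin n layer
    mergeProj-weight = sumFin-mono _ layer val-mergeProj

    -- Exactness forces one of the two copies of each vertex to carry 0, and
    -- its dominator in μ(G) yields a neighbour labelled 2 in G.
    mergeProj-special : sumFin n layer ≤ weight mergeProj →
      (∀ v → mergeProj v ≢ 𝟙) ×
      (∀ v → mergeProj v ≡ 𝟚 → Σ (Fin n) λ w → Adj G v w × mergeProj w ≡ 𝟚)
    mergeProj-special Σlayer≤ =
      (λ v → proj₂ (exact v)) , (λ v _ → mergeProj-dominated v (proj₁ (exact v)))
      where
      exact : ∀ j → (g₀ j ≡ zero ⊎ g₁ j ≡ zero) × mergeProj j ≢ 𝟙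
      exact j = merge-exact (g₀ j) (g₁ j)
        (sumFin-mono-exact (val ∘ mergeProj) layer val-mergeProj Σlayer≤ j)

  module Raise (gᵤ≡0 : gᵤ ≡ zero) where

    v0Dominated? : ∀ j → Dec (V0Dominated j)
    v0Dominated? j = any? (λ j' → (adj G j j' ≟ᵇ true) ×-dec (g₀ j' ≟ᶠ 𝟚))

    raiseProj : Fin n → Fin 3
    raiseProj j = raise (g₀ j) (v0Dominated? j)

    raiseProj-rdf : IsRDF G raiseProj
    raiseProj-rdf j eq with raise-≡0 (g₀ j) (v0Dominated? j) eq
    ... | j' , j~j' , e = j' , j~j' , raise-𝟚 (v0Dominated? j') e

    val-raiseProj : ∀ j → val (raiseProj j) ≤ layer j
    val-raiseProj j = val-raise (g₀ j) (g₁ j) (v0Dominated? j) g₁≢0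
      where
      g₁≢0 : ¬ V0Dominated j → g₁ j ≢ zero
      g₁≢0 ¬dom g₁j≡0 with v1-dominated j g₁j≡0
      ... | inj₂ dom  = ¬dom dom
      ... | inj₁ gᵤ≡𝟚 with trans (sym gᵤ≡0) gᵤ≡𝟚
      ...   | ()

    raiseProj-weight-at : ∀ a → val (raiseProj a) + 2 ≤ layer a → weight raiseProj + 2 ≤ sumFin n layer
    raiseProj-weight-at = sumFin-mono-+-at (val ∘ raiseProj) layer val-raiseProj

    -- The vertex a with g(v¹ₐ) = 2 that dominates u pays for two units:
    -- either alone, or together with the neighbour j' of a whose v¹ⱼ'
    -- dominates v⁰ₐ.
    raiseProj-weight : weight raiseProj + 2 ≤ sumFin n layer
    raiseProj-weight with u-dominated gᵤ≡0
    ... | a , g₁a≡𝟚 with g₀ a ≟ᶠ zero | v0Dominated? a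
    ... | no g₀a≢0 | _     = raiseProj-weight-at a (raise-+2 (g₀ a) (v0Dominated? a) g₁a≡𝟚 (inj₁ g₀a≢0))
    ... | yes _    | yes t = raiseProj-weight-at a (raise-+2 (g₀ a) (v0Dominated? a) g₁a≡𝟚 (inj₂ t))
    ... | yes g₀a≡0 | no ¬t with v0-dominated a g₀a≡0
    ...   | j' , a~j' , inj₁ e = contradiction (j' , a~j' , e) ¬t
    ...   | j' , a~j' , inj₂ e =
      sumFin-mono-+-at₂ (val ∘ raiseProj) layer val-raiseProj (adj⇒≢ G a~j')
        (raise-+1 (g₀ a) (v0Dominated? a) g₁a≡𝟚) (raise-+1 (g₀ j') (v0Dominated? j') e)

module Bounds {n} (G : Graph n) (k : ℕ) (minimal : ∀ f → IsRDF G f → k ≤ weight f)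
              (g : Fin (suc (n + n)) → Fin 3) (rdf : IsRDF (mycielskian G) g) where

  open Projection G g rdf
  open ≤-Reasoning

  weight-at : ∀ {c} → gᵤ ≡ c → weight g ≡ val c + sumFin n layer
  weight-at gᵤ≡c = trans weight-layers (cong (λ c → val c + sumFin n layer) gᵤ≡c)

  centreExcess : Fin 3 → ℕ
  centreExcess 𝟙 = 0
  centreExcess _ = 1

  weight-≥-at : ∀ c → gᵤ ≡ c → suc k + centreExcess c ≤ weight g
  weight-≥-at zero gᵤ≡0 = begin
    suc k + 1             ≡⟨ sym (+-suc k 1) ⟩
    k + 2                 ≤⟨ +-monoˡ-≤ 2 (minimal raiseProj raiseProj-rdf) ⟩
    weight raiseProj + 2  ≤⟨ raiseProj-weight ⟩
    sumFin n layer        ≡⟨ sym (weight-at gᵤ≡0) ⟩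
    weight g              ∎
    where open Raise gᵤ≡0
  weight-≥-at 𝟙 gᵤ≡𝟙 = begin
    suc k + 0                   ≡⟨ +-identityʳ (suc k) ⟩
    suc k                       ≤⟨ s≤s (minimal mergeProj mergeProj-rdf) ⟩
    suc (weight mergeProj)      ≤⟨ s≤s mergeProj-weight ⟩
    suc (sumFin n layer)        ≡⟨ sym (weight-at gᵤ≡𝟙) ⟩
    weight g                    ∎
    where open Merge (≡𝟙⇒≢𝟚 gᵤ≡𝟙)
  weight-≥-at 𝟚 gᵤ≡𝟚 = begin
    suc k + 1                   ≡⟨ +-comm (suc k) 1 ⟩
    2 + k                       ≤⟨ +-monoʳ-≤ 2 (minimal maxProj maxProj-rdf) ⟩
    2 + weight maxProj          ≤⟨ +-monoʳ-≤ 2 maxProj-weight ⟩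
    2 + sumFin n layer          ≡⟨ sym (weight-at gᵤ≡𝟚) ⟩
    weight g                    ∎

  weight-≥ : suc k ≤ weight g
  weight-≥ = ≤-trans (m≤m+n (suc k) _) (weight-≥-at gᵤ refl)

  special-at : ∀ c → gᵤ ≡ c → weight g ≡ suc k → IsSpecialRoman G
  special-at zero gᵤ≡0 w =
    contradiction (subst (suc k + 1 ≤_) w (weight-≥-at zero gᵤ≡0)) (m+1+n≰m (suc k))
  special-at 𝟚    gᵤ≡𝟚 w =
    contradiction (subst (suc k + 1 ≤_) w (weight-≥-at 𝟚 gᵤ≡𝟚)) (m+1+n≰m (suc k))
  special-at 𝟙    gᵤ≡𝟙 w = mergeProj , (mergeProj-rdf , optimal) , mergeProj-special exact
    where
    open Merge (≡𝟙⇒≢𝟚 gᵤ≡𝟙)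
    layer≡k : sumFin n layer ≡ k
    layer≡k = suc-injective (trans (sym (weight-at gᵤ≡𝟙)) w)
    optimal : ∀ f → IsRDF G f → weight mergeProj ≤ weight f
    optimal f rdf-f = ≤-trans (subst (weight mergeProj ≤_) layer≡k mergeProj-weight) (minimal f rdf-f)
    exact : sumFin n layer ≤ weight mergeProj
    exact = subst (_≤ weight mergeProj) (sym layer≡k) (minimal mergeProj mergeProj-rdf)

  special : weight g ≡ suc k → IsSpecialRoman G
  special = special-at gᵤ refl

module Extension {n} (G : Graph n) (f : Fin n → Fin 3) (rdf : IsRDF G f)
                 (no𝟙 : ∀ v → f v ≢ 𝟙)
                 (no-isolated : ∀ v → f v ≡ 𝟚 → Σ (Fin n) λ w → Adj G v w × f w ≡ 𝟚) where

  two-neighbour : ∀ j → Σ (Fin n) λ w → Adj G j w × f w ≡ 𝟚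
  two-neighbour j with f j in eq
  ... | zero = rdf j eq
  ... | 𝟙    = contradiction eq (no𝟙 j)
  ... | 𝟚    = no-isolated j eq

  F : MyVert n → Fin 3
  F u      = 𝟙
  F (v0 j) = f j
  F (v1 j) = zero

  F-dominating : ∀ m → F m ≡ zero → MyDominated G F m
  F-dominating (v0 j) f≡0 with rdf j f≡0
  ... | w , j~w , e = v0 w , j~w , e
  F-dominating (v1 j) _ with two-neighbour j
  ... | w , j~w , e = v0 w , j~w , e

  extension : Fin (suc (n + n)) → Fin 3
  extension = F ∘ classify

  extension-rdf : IsRDF (mycielskian G) extension
  extension-rdf = rdf-mycielskian⇐ G F F-dominating

  extension-weight : weight extension ≡ suc (weight f)
  extension-weight = trans (weight-mycielskian {n} extension) (cong suc (sumFin-cong layer≡f))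
    where
    layer≡f : ∀ j → val (extension (embed (v0 j))) + val (extension (embed (v1 j))) ≡ val (f j)
    layer≡f j = trans (cong₂ (λ x y → val (F x) + val (F y)) (classify-embed (v0 j)) (classify-embed (v1 j)))
                      (+-identityʳ (val (f j)))

theorem5 : ∀ {n} (G : Graph n) (k : ℕ) → IsRomanDomNumber G k →
    (IsRomanDomNumber (mycielskian G) (suc k) ⇔ IsSpecialRoman G)
theorem5 G k ((f₀ , rdf₀ , weight-f₀) , minimal) = mk⇔ to from
  where
  to : IsRomanDomNumber (mycielskian G) (suc k) → IsSpecialRoman G
  to ((g , rdf , weight-g) , _) = Bounds.special G k minimal g rdf weight-g

  from : IsSpecialRoman G → IsRomanDomNumber (mycielskian G) (suc k)
  from (f , (rdf , optimal) , no𝟙 , no-isolated) =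
    (extension , extension-rdf , trans extension-weight (cong suc weight-f)) ,
    λ g rdf-g → Bounds.weight-≥ G k minimal g rdf-g
    where
    open Extension G f rdf no𝟙 no-isolated
    weight-f : weight f ≡ k
    weight-f = ≤-antisym (subst (weight f ≤_) weight-f₀ (optimal f₀ rdf₀)) (minimal f rdf)
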